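{- Let $B$ be a prime bouquet with $e(B)=n$ edges, where $n\geq 2$. Then $f(B)\leq n$. Moreover, $f(B)=n$ if and only if $B$ has (for a suitable labelling $e_1,\dots,e_n$ of its loops) the signed rotation $[e_1,e_2,\ldots,e_n,-e_1,-e_2,\ldots,-e_n]$.
   Context: A bouquet is a ribbon graph with exactly one vertex disc, its edges being loops; $f(B)$ denotes the number of boundary components of the surface $B$ and $e(B)$ its number of edges. A signed rotation of a bouquet is the cyclic ordering of the half-edges (loop ends) around the vertex, where for an orientable (untwisted) loop the two ends receive the same sign and for a non-orientable (twisted) loop they receive opposite signs; $+$ is omitted. Reversing both signs of a loop gives an equivalent signed rotation, and the cyclic starting point is irrelevant. The one-vertex-join $P\vee Q$ of disjoint ribbon graphs is formed by choosing an arc on the boundary of a vertex of $P$ between two consecutive ribbon ends and such an arc on a vertex of $Q$, and identifying these arcs. A ribbon graph $G$ is prime if there are no non-empty ribbon subgraphs $G_1,\dots,G_k$ ($k\geq 2$) with $G=G_1\vee\cdots\vee G_k$; equivalently for a bouquet, its intersection graph (vertices the loops, adjacent iff their ends alternate around the vertex) is connected. -}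

module Defs where

open import Data.Nat using (ℕ; zero; suc; _+_; _*_; _≤ᵇ_)
open import Data.Nat.DivMod using (_mod_)
open import Data.Bool using (Bool; true; false; _xor_; _∧_; if_then_else_)
open import Data.Fin using (Fin; toℕ)
open import Data.List using (List; []; _∷_; map; allFin; upTo; concatMap)
open import Data.Nat.ListAction using (sum)
open import Data.Bool.ListAction using (and)
open import Data.Product using (Σ; ∃; _×_; _,_)
open import Data.Sum using (_⊎_)
open import Relation.Nullary using (¬_)
open import Relation.Binary.PropositionalEquality using (_≡_; _≢_)
open import Relation.Binary.Construct.Closure.ReflexiveTransitive using (Star)

-- Signs: true = "+", false = "-".

Sign : Set
Sign = Bool

next : ∀ {m} → Fin m → Fin m
next {suc m} i = suc (toℕ i) mod suc m

prev : ∀ {m} → Fin m → Fin m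
prev {suc m} i = (toℕ i + m) mod suc m

shift : ∀ {m} → Fin m → ℕ → Fin m
shift r zero    = r
shift r (suc k) = next (shift r k)

-- A bouquet with n edges (loops), given by its signed rotation:
-- the 2n ribbon ends around the vertex, in cyclic order, are the
-- positions Fin (2 * n); position p carries the loop  lab p  with sign
-- sgn p.  Every loop has exactly two ends:  partner p  is the other end
-- of the loop at p.

record Bouquet (n : ℕ) : Set where
  field
    lab         : Fin (2 * n) → Fin n
    sgn         : Fin (2 * n) → Sign
    partner     : Fin (2 * n) → Fin (2 * n)
    partner-inv : ∀ p → partner (partner p) ≡ p
    partner-ne  : ∀ p → partner p ≢ p
    partner-lab : ∀ p → lab (partner p) ≡ lab p
    two-ends    : ∀ p q → lab p ≡ lab q → q ≡ p ⊎ q ≡ partner p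
    every-loop  : ∀ e → ∃ λ p → lab p ≡ e

open Bouquet public

twisted : ∀ {n} → Bouquet n → Fin (2 * n) → Bool
twisted B p = sgn B p xor sgn B (partner B p)

-- Each ribbon end p has two sides: L (towards the previous end) and R
-- (towards the next end).  The boundary of the surface consists of
--  * vertex arcs:  (p , R) — (next p , L)
--  * edge sides:   for an untwisted loop  (p , R) — (partner p , L),
--                  (p , L) — (partner p , R);
--                  for a twisted loop     (p , R) — (partner p , R),
--                  (p , L) — (partner p , L).
-- These are two fixed-point-free involutions α (arcs) and ε (edge sides)
-- on the 4n side-points; the boundary components are exactly the
-- connected components of the resulting 2-regular graph.

data Side : Set where
  L R : Side

Node : ℕ → Set
Node n = Fin (2 * n) × Side

arcα : ∀ {n} → Node n → Node n
arcα (p , R) = next p , L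
arcα (p , L) = prev p , R

flipSide : Side → Side
flipSide L = R
flipSide R = L

edgeε : ∀ {n} → Bouquet n → Node n → Node n
edgeε B (p , s) =
  partner B p , (if twisted B p then s else flipSide s)

step : ∀ {n} → Bouquet n → Node n → Node n
step {n} B x = edgeε B (arcα {n} x)

stepIter : ∀ {n} → Bouquet n → ℕ → Node n → Node n
stepIter B zero    x = x
stepIter B (suc k) x = step B (stepIter B k x)

key : ∀ {n} → Node n → ℕ
key (p , L) = 2 * toℕ p
key (p , R) = suc (2 * toℕ p)

-- The component of x is { stepIter k x } ∪ { α (stepIter k x) }, k < 4n.
-- x represents its component iff it has the least key in it.
isRep : ∀ {n} → Bouquet n → Node n → Bool
isRep {n} B x =
  and (map (λ k → (key {n} x ≤ᵇ key {n} (stepIter B k x))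
                ∧ (key {n} x ≤ᵇ key {n} (arcα {n} (stepIter B k x))))
           (upTo (4 * n)))

allNodes : (n : ℕ) → List (Node n)
allNodes n = concatMap (λ p → (p , L) ∷ (p , R) ∷ []) (allFin (2 * n))

f : ∀ {n} → Bouquet n → ℕ
f {n} B = sum (map (λ x → if isRep B x then 1 else 0) (allNodes n))

-- Primeness via the intersection graph: loops e, e' are adjacent iff
-- their ends alternate around the vertex, i.e. exactly one end of e'
-- lies strictly between the two ends of e.

StrictlyBetween : ∀ {m} → Fin m → Fin m → Fin m → Set
StrictlyBetween {m} a b c =
  (toℕ a Data.Nat.< toℕ c × toℕ c Data.Nat.< toℕ b)
  ⊎ (toℕ b Data.Nat.< toℕ c × toℕ c Data.Nat.< toℕ a)

Interlaced : ∀ {n} → Bouquet n → Fin n → Fin n → Set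
Interlaced B e e' =
  Σ _ λ p → Σ _ λ q → lab B p ≡ e × lab B q ≡ e'
    × StrictlyBetween p (partner B p) q
    × ¬ StrictlyBetween p (partner B p) (partner B q)

Prime : ∀ {n} → Bouquet n → Set
Prime B = ∀ e e' → Star (Interlaced B) e e'

-- B has signed rotation [e₁,…,eₙ,-e₁,…,-eₙ] for a suitable labelling:
-- for some starting point r, some labelling π of the loops, and some
-- choice of which loops get both signs reversed (an equivalent signed
-- rotation), reading from r gives π 0, …, π (n-1) with sign + and then
-- π 0, …, π (n-1) with sign −.

HasStandardRotation : ∀ {n} → Bouquet n → Set
HasStandardRotation {n} B =
  Σ (Fin (2 * n)) λ r → Σ (Fin n → Fin n) λ π → Σ (Fin n → Bool) λ rev →
    ∀ (i : Fin n) →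
        lab B (shift r (toℕ i)) ≡ π i
      × (sgn B (shift r (toℕ i)) xor rev (π i)) ≡ true
      × lab B (shift r (n + toℕ i)) ≡ π i
      × (sgn B (shift r (n + toℕ i)) xor rev (π i)) ≡ false

module Submission where

-- The boundary of B is traced on the 4n sides of the 2n ribbon ends by two
-- fixed-point-free involutions, α (arcs of the vertex) and ε (sides of the loops); the
-- boundary components are the orbits of the group they generate, so each contains
-- x, α x, ρ x and α (ρ x) for ρ = ε ∘ α.  A fixed point of ρ is a loop whose two ends are
-- adjacent, and such a loop is interlaced with no other loop, which primality and n ≥ 2
-- exclude.  So all orbits have at least four points, f(B) ≤ n, and f(B) = n exactly when
-- ρ is an involution.  Locally, ρ² = id says that consecutive ends are equally twisted
-- and that their partners are consecutive too, in the same direction for twisted loops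
-- and in the opposite one for untwisted loops.  In the untwisted case the partner map is
-- a reflection of the 2n-cycle, which fixes a point or swaps two neighbours: impossible.
-- In the twisted case it is a rotation, and a fixed-point-free involutive rotation is the
-- half-turn p ↦ p + n: every loop is twisted and joins opposite ends, which is the
-- signed rotation [e₁, …, eₙ, −e₁, …, −eₙ].

open import Defs
open import Data.Bool using (Bool; true; false; not; _∧_; _xor_; if_then_else_; T)
open import Data.Bool.ListAction using (and; all)
open import Data.Bool.Properties using (T-∧; xor-comm; xor-same; xor-inverseʳ)
open import Data.Fin using (Fin; zero; suc; toℕ; fromℕ<)
open import Data.Fin.Properties using (toℕ-injective; toℕ<n; toℕ-fromℕ<; pigeonhole) renaming (_≟_ to _≟-fin_)
open import Data.List using (List; []; _∷_; map; _++_; length; upTo; allFin; concatMap; cartesianProduct)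
open import Data.List.Extrema.Nat using (argmin; argmin-sel; f[argmin]≤f[xs])
open import Data.List.Membership.Propositional using (_∈_)
open import Data.List.Membership.Propositional.Properties using (∈-map⁺; ∈-map⁻; ∈-++⁺ˡ; ∈-++⁺ʳ; ∈-++⁻; ∈-upTo⁺; ∈-allFin; ∈-cartesianProduct⁺)
import Data.List.Membership.DecPropositional as DecMembership
open import Data.List.Properties using (map-cong; length-tabulate)
open import Data.List.Relation.Unary.All as All using (All; []; _∷_)
open import Data.List.Relation.Unary.All.Properties using (all⁺; all⁻; applyUpTo⁺₁; applyUpTo⁻)
open import Data.List.Relation.Unary.AllPairs using ([]; _∷_)
open import Data.List.Relation.Unary.Any using (here; there)
open import Data.List.Relation.Unary.Unique.Propositional using (Unique)
open import Data.List.Relation.Unary.Unique.Propositional.Properties using (allFin⁺; cartesianProduct⁺)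
open import Data.Nat using (ℕ; zero; suc; _+_; _*_; _∸_; _≤_; _<_; _≤ᵇ_; _<?_; z≤n; s≤s)
open import Data.Nat.DivMod using (_%_; _/_; m≡m%n+[m/n]*n; m%n<n; %-distribˡ-+; m%n%n≡m%n; [m+n]%n≡m%n; m<n⇒m%n≡m; n%n≡0)
open import Data.Nat.ListAction using (sum)
open import Data.Nat.Properties
open import Algebra.Properties.CommutativeSemigroup +-commutativeSemigroup using (interchange)
open import Data.Nat.Solver using (module +-*-Solver)
open import Data.Product using (_×_; _,_; ∃-syntax; proj₁; proj₂)
open import Data.Product.Properties using (≡-dec)
open import Data.Sum using (_⊎_; inj₁; inj₂)
open import Function using (_∘_; _⇔_; mk⇔; Equivalence)
import Function.Properties.Equivalence as ⇔
open import Relation.Binary using (Rel; Decidable)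
open import Relation.Binary.Construct.Closure.ReflexiveTransitive as Star using (Star)
open import Relation.Binary.Definitions using (DecidableEquality)
open import Relation.Binary.PropositionalEquality
open import Relation.Nullary using (¬_; does; yes; no; contradiction)
open import Relation.Nullary.Decidable using (map′; isYes; toWitness; fromWitness)

open +-*-Solver using (solve; _:+_; _:*_; _:=_; con)

-- Sums over lists and double counting

𝟙 : Bool → ℕ
𝟙 b = if b then 1 else 0

∑ : {A : Set} → List A → (A → ℕ) → ℕ
∑ xs g = sum (map g xs)

infix 5 ∑
syntax ∑ xs (λ x → e) = ∑[ x ∈ xs ] e

module _ {A : Set} where

  ∑-cong : ∀ xs {g h : A → ℕ} → (∀ x → g x ≡ h x) → ∑ xs g ≡ ∑ xs h
  ∑-cong []       eq = refl
  ∑-cong (x ∷ xs) eq = cong₂ _+_ (eq x) (∑-cong xs eq)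

  ∑-mono-≤ : ∀ xs {g h : A → ℕ} → (∀ x → g x ≤ h x) → ∑ xs g ≤ ∑ xs h
  ∑-mono-≤ []       le = z≤n
  ∑-mono-≤ (x ∷ xs) le = +-mono-≤ (le x) (∑-mono-≤ xs le)

  ∑-zero : ∀ xs {g : A → ℕ} → (∀ x → g x ≡ 0) → ∑ xs g ≡ 0
  ∑-zero []       eq = refl
  ∑-zero (x ∷ xs) eq = cong₂ _+_ (eq x) (∑-zero xs eq)

  ∑-one : ∀ (xs : List A) → ∑[ x ∈ xs ] 1 ≡ length xs
  ∑-one []       = refl
  ∑-one (x ∷ xs) = cong suc (∑-one xs)

  ∑-distrib-+ : ∀ xs (g h : A → ℕ) → ∑[ x ∈ xs ] (g x + h x) ≡ ∑ xs g + ∑ xs h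
  ∑-distrib-+ []       g h = refl
  ∑-distrib-+ (x ∷ xs) g h = begin
    g x + h x + (∑[ x ∈ xs ] (g x + h x))  ≡⟨ cong (g x + h x +_) (∑-distrib-+ xs g h) ⟩
    g x + h x + (∑ xs g + ∑ xs h)          ≡⟨ interchange (g x) (h x) (∑ xs g) (∑ xs h) ⟩
    g x + ∑ xs g + (h x + ∑ xs h)          ∎
    where open ≡-Reasoning

  *-distribˡ-∑ : ∀ c xs (g : A → ℕ) → c * ∑ xs g ≡ ∑[ x ∈ xs ] c * g x
  *-distribˡ-∑ c []       g = *-zeroʳ c
  *-distribˡ-∑ c (x ∷ xs) g = trans (*-distribˡ-+ c (g x) (∑ xs g)) (cong (c * g x +_) (*-distribˡ-∑ c xs g))

∑-comm : {A B : Set} (xs : List A) (ys : List B) (g : A → B → ℕ) →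
         ∑[ x ∈ xs ] ∑[ y ∈ ys ] g x y ≡ ∑[ y ∈ ys ] ∑[ x ∈ xs ] g x y
∑-comm []       ys g = sym (∑-zero ys (λ _ → refl))
∑-comm (x ∷ xs) ys g = begin
  ∑ ys (g x) + (∑[ x ∈ xs ] ∑[ y ∈ ys ] g x y)  ≡⟨ cong (∑ ys (g x) +_) (∑-comm xs ys g) ⟩
  ∑ ys (g x) + (∑[ y ∈ ys ] ∑[ x ∈ xs ] g x y)  ≡⟨ ∑-distrib-+ ys (g x) _ ⟨
  (∑[ y ∈ ys ] (g x y + (∑[ x ∈ xs ] g x y)))   ∎
  where open ≡-Reasoning

module Counting {X : Set} (_≟_ : DecidableEquality X) where

  δ : X → X → ℕ
  δ a x = 𝟙 (does (a ≟ x))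

  δ-sym : ∀ a x → δ a x ≡ δ x a
  δ-sym a x with a ≟ x | x ≟ a
  ... | yes _    | yes _    = refl
  ... | no  _    | no  _    = refl
  ... | yes refl | no  x≢a  = contradiction refl x≢a
  ... | no  a≢x  | yes refl = contradiction refl a≢x

  ∑-δ-∉ : ∀ {a} Q → All (a ≢_) Q → ∑[ x ∈ Q ] δ a x ≡ 0
  ∑-δ-∉ []       []            = refl
  ∑-δ-∉ {a} (x ∷ Q) (a≢x ∷ a∉Q) with a ≟ x
  ... | yes a≡x = contradiction a≡x a≢x
  ... | no  _   = ∑-δ-∉ Q a∉Q

  ∑-δ-≤1 : ∀ {a} Q → Unique Q → ∑[ x ∈ Q ] δ a x ≤ 1
  ∑-δ-≤1 []       []            = z≤n
  ∑-δ-≤1 {a} (x ∷ Q) (x∉Q ∷ Q!) with a ≟ x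
  ... | yes refl = ≤-reflexive (cong suc (∑-δ-∉ Q x∉Q))
  ... | no  _    = ∑-δ-≤1 Q Q!

  ∑-δ-∈ : ∀ {a} Q → Unique Q → a ∈ Q → ∑[ x ∈ Q ] δ a x ≡ 1
  ∑-δ-∈ {a} (x ∷ Q) (x∉Q ∷ Q!) a∈xQ with a ≟ x | a∈xQ
  ... | yes refl | _         = cong suc (∑-δ-∉ Q x∉Q)
  ... | no  a≢x  | here a≡x  = contradiction a≡x a≢x
  ... | no  _    | there a∈Q = ∑-δ-∈ Q Q! a∈Q

  ∑-δ-≥1 : ∀ {a} Q → a ∈ Q → 1 ≤ ∑[ x ∈ Q ] δ a x
  ∑-δ-≥1 {a} (x ∷ Q) a∈xQ with a ≟ x | a∈xQ
  ... | yes _   | _         = s≤s z≤n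
  ... | no  a≢x | here a≡x  = contradiction a≡x a≢x
  ... | no  _   | there a∈Q = ∑-δ-≥1 Q a∈Q

  module Enumeration {xs : List X} (xs! : Unique xs) (complete : ∀ x → x ∈ xs) where

    count : (X → Bool) → ℕ
    count P = ∑[ x ∈ xs ] 𝟙 (P x)

    length≡∑∑δ : ∀ Q → length Q ≡ ∑[ y ∈ xs ] ∑[ q ∈ Q ] δ y q
    length≡∑∑δ Q = begin
      length Q                        ≡⟨ ∑-one Q ⟨
      (∑[ q ∈ Q ] 1)                  ≡⟨ ∑-cong Q (λ q → ∑-δ-∈ xs xs! (complete q)) ⟨
      (∑[ q ∈ Q ] ∑[ y ∈ xs ] δ q y)  ≡⟨ ∑-comm Q xs δ ⟩
      (∑[ y ∈ xs ] ∑[ q ∈ Q ] δ q y)  ≡⟨ ∑-cong xs (λ y → ∑-cong Q (λ q → δ-sym q y)) ⟩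
      (∑[ y ∈ xs ] ∑[ q ∈ Q ] δ y q)  ∎
      where open ≡-Reasoning

    length≤count : ∀ P Q → Unique Q → All (T ∘ P) Q → length Q ≤ count P
    length≤count P Q Q! PQ = ≤-trans (≤-reflexive (length≡∑∑δ Q)) (∑-mono-≤ xs bound)
      where
      bound : ∀ y → ∑[ q ∈ Q ] δ y q ≤ 𝟙 (P y)
      bound y with P y in Py
      ... | true  = ∑-δ-≤1 Q Q!
      ... | false = ≤-reflexive (∑-δ-∉ Q (All.map (λ Pq y≡q → subst T Py (subst (T ∘ P) (sym y≡q) Pq)) PQ))

    count≤length : ∀ P Q → (∀ y → T (P y) → y ∈ Q) → count P ≤ length Q
    count≤length P Q PQ = ≤-trans (∑-mono-≤ xs bound) (≤-reflexive (sym (length≡∑∑δ Q)))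
      where
      bound : ∀ y → 𝟙 (P y) ≤ ∑[ q ∈ Q ] δ y q
      bound y with P y in Py
      ... | true  = ∑-δ-≥1 Q (PQ y (subst T (sym Py) _))
      ... | false = z≤n

    module _ (rep : X → Bool) (R : X → X → Bool)
             (unique-rep : ∀ y → ∃[ r ] T (rep r) × T (R r y) × (∀ x → T (rep x) → T (R x y) → x ≡ r)) where

      ∑-reps-of≡1 : ∀ y → ∑[ x ∈ xs ] 𝟙 (rep x) * 𝟙 (R x y) ≡ 1
      ∑-reps-of≡1 y with unique-rep y
      ... | r , rep-r , Rry , only = trans (∑-cong xs entry) (∑-δ-∈ xs xs! (complete r))
        where
        entry : ∀ x → 𝟙 (rep x) * 𝟙 (R x y) ≡ δ r x
        entry x with r ≟ x
        entry x | yes refl with rep x | R x y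
        ... | true | true = refl
        entry x | no r≢x with rep x in rep-x | R x y in Rxy
        ... | true  | true  = contradiction (sym (only x (subst T (sym rep-x) _) (subst T (sym Rxy) _))) r≢x
        ... | true  | false = refl
        ... | false | _     = refl

      ∑-class-sizes : ∑[ x ∈ xs ] 𝟙 (rep x) * count (R x) ≡ length xs
      ∑-class-sizes = begin
        (∑[ x ∈ xs ] 𝟙 (rep x) * count (R x))            ≡⟨ ∑-cong xs (λ x → *-distribˡ-∑ (𝟙 (rep x)) xs (𝟙 ∘ R x)) ⟩
        (∑[ x ∈ xs ] ∑[ y ∈ xs ] 𝟙 (rep x) * 𝟙 (R x y))  ≡⟨ ∑-comm xs xs _ ⟩
        (∑[ y ∈ xs ] ∑[ x ∈ xs ] 𝟙 (rep x) * 𝟙 (R x y))  ≡⟨ ∑-cong xs ∑-reps-of≡1 ⟩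
        (∑[ y ∈ xs ] 1)                                  ≡⟨ ∑-one xs ⟩
        length xs                                        ∎
        where open ≡-Reasoning

-- Orbits of the group generated by two involutions

involutive⇒injective : {A : Set} {g : A → A} → (∀ x → g (g x) ≡ x) → ∀ {x y} → g x ≡ g y → x ≡ y
involutive⇒injective {g = g} inv {x} {y} gx≡gy = trans (sym (inv x)) (trans (cong g gx≡gy) (inv y))

module TwoInvolutions {X : Set} (_≟_ : DecidableEquality X)
  (α ε : X → X) (α-involutive : ∀ x → α (α x) ≡ x) (ε-involutive : ∀ x → ε (ε x) ≡ x)
  {N : ℕ} (key : X → ℕ) (key<N : ∀ x → key x < N) (key-injective : ∀ {x y} → key x ≡ key y → x ≡ y)
  where

  ρ : X → X
  ρ x = ε (α x)

  ρ^ : ℕ → X → X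
  ρ^ zero    x = x
  ρ^ (suc j) x = ρ (ρ^ j x)

  ρ^-+ : ∀ i j x → ρ^ (i + j) x ≡ ρ^ i (ρ^ j x)
  ρ^-+ zero    j x = refl
  ρ^-+ (suc i) j x = cong ρ (ρ^-+ i j x)

  ρ^-comm : ∀ i j x → ρ^ i (ρ^ j x) ≡ ρ^ j (ρ^ i x)
  ρ^-comm i j x = trans (sym (ρ^-+ i j x)) (trans (cong (λ k → ρ^ k x) (+-comm i j)) (ρ^-+ j i x))

  ρ-injective : ∀ {x y} → ρ x ≡ ρ y → x ≡ y
  ρ-injective = involutive⇒injective {g = α} α-involutive ∘ involutive⇒injective {g = ε} ε-involutive

  ρ^-injective : ∀ j {x y} → ρ^ j x ≡ ρ^ j y → x ≡ y
  ρ^-injective zero    eq = eq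
  ρ^-injective (suc j) eq = ρ^-injective j (ρ-injective eq)

  ρ∘α∘ρ : ∀ x → ρ (α (ρ x)) ≡ α x
  ρ∘α∘ρ x = trans (cong ε (α-involutive (ε (α x)))) (ε-involutive (α x))

  ρ^∘α∘ρ^ : ∀ j x → ρ^ j (α (ρ^ j x)) ≡ α x
  ρ^∘α∘ρ^ zero    x = refl
  ρ^∘α∘ρ^ (suc j) x = begin
    ρ^ (suc j) (α (ρ (ρ^ j x)))  ≡⟨ ρ^-comm 1 j _ ⟩
    ρ^ j (ρ (α (ρ (ρ^ j x))))    ≡⟨ cong (ρ^ j) (ρ∘α∘ρ (ρ^ j x)) ⟩
    ρ^ j (α (ρ^ j x))            ≡⟨ ρ^∘α∘ρ^ j x ⟩
    α x                          ∎
    where open ≡-Reasoning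

  periodic : ∀ x → ∃[ p ] suc p ≤ N × ρ^ (suc p) x ≡ x
  periodic x with pigeonhole (n<1+n N) (λ i → fromℕ< (key<N (ρ^ (toℕ i) x)))
  ... | i , j , i<j , same-key = toℕ j ∸ toℕ i ∸ 1 , period≤N , returns
    where
    d = toℕ j ∸ toℕ i
    suc[d∸1]≡d : suc (d ∸ 1) ≡ d
    suc[d∸1]≡d = m+[n∸m]≡n (m<n⇒0<n∸m i<j)
    period≤N : suc (d ∸ 1) ≤ N
    period≤N = ≤-trans (≤-reflexive suc[d∸1]≡d) (≤-trans (m∸n≤m (toℕ j) (toℕ i)) (≤-pred (toℕ<n j)))
    i-th≡j-th : ρ^ (toℕ i) x ≡ ρ^ (toℕ j) x
    i-th≡j-th = key-injective (begin
      key (ρ^ (toℕ i) x)                   ≡⟨ toℕ-fromℕ< _ ⟨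
      toℕ (fromℕ< (key<N (ρ^ (toℕ i) x)))  ≡⟨ cong toℕ same-key ⟩
      toℕ (fromℕ< (key<N (ρ^ (toℕ j) x)))  ≡⟨ toℕ-fromℕ< _ ⟩
      key (ρ^ (toℕ j) x)                   ∎)
      where open ≡-Reasoning
    returns : ρ^ (suc (d ∸ 1)) x ≡ x
    returns = ρ^-injective (toℕ i) (begin
      ρ^ (toℕ i) (ρ^ (suc (d ∸ 1)) x)  ≡⟨ cong (λ k → ρ^ (toℕ i) (ρ^ k x)) suc[d∸1]≡d ⟩
      ρ^ (toℕ i) (ρ^ d x)              ≡⟨ ρ^-+ (toℕ i) d x ⟨
      ρ^ (toℕ i + d) x                 ≡⟨ cong (λ k → ρ^ k x) (m+[n∸m]≡n (<⇒≤ i<j)) ⟩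
      ρ^ (toℕ j) x                     ≡⟨ i-th≡j-th ⟨
      ρ^ (toℕ i) x                     ∎)
      where open ≡-Reasoning

  ρ^-*-period : ∀ {x} p → ρ^ (suc p) x ≡ x → ∀ t → ρ^ (t * suc p) x ≡ x
  ρ^-*-period p back zero    = refl
  ρ^-*-period {x} p back (suc t) =
    trans (ρ^-+ (suc p) (t * suc p) x) (trans (cong (ρ^ (suc p)) (ρ^-*-period p back t)) back)

  ρ^-undo : ∀ j x → ∃[ i ] ρ^ i (ρ^ j x) ≡ x
  ρ^-undo j x with periodic x
  ... | p , _ , back = p * j , (begin
    ρ^ (p * j) (ρ^ j x)  ≡⟨ ρ^-+ (p * j) j x ⟨
    ρ^ (p * j + j) x     ≡⟨ cong (λ k → ρ^ k x) (trans (+-comm (p * j) j) (*-comm (suc p) j)) ⟩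
    ρ^ (j * suc p) x     ≡⟨ ρ^-*-period p back j ⟩
    x                    ∎)
    where open ≡-Reasoning

  ρ^-bounded : ∀ j x → ∃[ i ] i < N × ρ^ j x ≡ ρ^ i x
  ρ^-bounded j x with periodic x
  ... | p , period≤N , back = j % suc p , ≤-trans (m%n<n j (suc p)) period≤N , (begin
    ρ^ j x                                     ≡⟨ cong (λ k → ρ^ k x) (m≡m%n+[m/n]*n j (suc p)) ⟩
    ρ^ (j % suc p + j / suc p * suc p) x       ≡⟨ ρ^-+ (j % suc p) _ x ⟩
    ρ^ (j % suc p) (ρ^ (j / suc p * suc p) x)  ≡⟨ cong (ρ^ (j % suc p)) (ρ^-*-period p back (j / suc p)) ⟩
    ρ^ (j % suc p) x                           ∎)
    where open ≡-Reasoning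

  Reaches : X → X → ℕ → Set
  Reaches x y j = y ≡ ρ^ j x ⊎ y ≡ α (ρ^ j x)

  _∼_ : Rel X _
  x ∼ y = ∃[ j ] Reaches x y j

  ∼-bounded : ∀ {x y} → x ∼ y → ∃[ i ] i < N × Reaches x y i
  ∼-bounded {x} (j , reach) with ρ^-bounded j x
  ... | i , i<N , eq = i , i<N , Data.Sum.map (λ y≡ → trans y≡ eq) (λ y≡ → trans y≡ (cong α eq)) reach

  ∼-refl : ∀ {x} → x ∼ x
  ∼-refl = 0 , inj₁ refl

  ∼-α : ∀ x → x ∼ α x
  ∼-α x = 0 , inj₂ refl

  ∼-ρ : ∀ x → x ∼ ρ x
  ∼-ρ x = 1 , inj₁ refl

  ∼-sym : ∀ {x y} → x ∼ y → y ∼ x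
  ∼-sym {x} (j , inj₁ refl) with ρ^-undo j x
  ... | i , undo = i , inj₁ (sym undo)
  ∼-sym {x} (j , inj₂ refl) = j , inj₂ (sym (trans (cong α (ρ^∘α∘ρ^ j x)) (α-involutive x)))

  ∼-trans : ∀ {x y z} → x ∼ y → y ∼ z → x ∼ z
  ∼-trans {x} (a , inj₁ refl) (b , inj₁ refl) = b + a , inj₁ (sym (ρ^-+ b a x))
  ∼-trans {x} (a , inj₁ refl) (b , inj₂ refl) = b + a , inj₂ (cong α (sym (ρ^-+ b a x)))
  ∼-trans {x} {z = z} (a , inj₂ refl) (b , reach) with ρ^-undo b x
  ... | i , undo = i + a , α-form reach
    where
    u = i + a
    b-th∘u-th : ρ^ b (ρ^ u x) ≡ ρ^ a x
    b-th∘u-th = begin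
      ρ^ b (ρ^ (i + a) x)   ≡⟨ cong (ρ^ b) (ρ^-+ i a x) ⟩
      ρ^ b (ρ^ i (ρ^ a x))  ≡⟨ ρ^-+ b i _ ⟨
      ρ^ (b + i) (ρ^ a x)   ≡⟨ ρ^-comm (b + i) a x ⟩
      ρ^ a (ρ^ (b + i) x)   ≡⟨ cong (ρ^ a) (trans (cong (λ k → ρ^ k x) (+-comm b i)) (ρ^-+ i b x)) ⟩
      ρ^ a (ρ^ i (ρ^ b x))  ≡⟨ cong (ρ^ a) undo ⟩
      ρ^ a x                ∎
      where open ≡-Reasoning
    through-α : ρ^ b (α (ρ^ a x)) ≡ α (ρ^ u x)
    through-α = trans (cong (ρ^ b ∘ α) (sym b-th∘u-th)) (ρ^∘α∘ρ^ b (ρ^ u x))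
    α-form : Reaches (α (ρ^ a x)) z b → Reaches x z u
    α-form (inj₁ refl) = inj₂ through-α
    α-form (inj₂ refl) = inj₁ (trans (cong α through-α) (α-involutive _))

  orbit : X → List X
  orbit x = map (λ j → ρ^ j x) (upTo N) ++ map (λ j → α (ρ^ j x)) (upTo N)

  ∈-orbit⁺ : ∀ {x y} → x ∼ y → y ∈ orbit x
  ∈-orbit⁺ x∼y with ∼-bounded x∼y
  ... | j , j<N , inj₁ refl = ∈-++⁺ˡ (∈-map⁺ _ (∈-upTo⁺ j<N))
  ... | j , j<N , inj₂ refl = ∈-++⁺ʳ _ (∈-map⁺ _ (∈-upTo⁺ j<N))

  ∈-orbit⁻ : ∀ {x y} → y ∈ orbit x → x ∼ y
  ∈-orbit⁻ {x} y∈orbit with ∈-++⁻ (map (λ j → ρ^ j x) (upTo N)) y∈orbit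
  ... | inj₁ y∈powers with ∈-map⁻ _ y∈powers
  ...   | j , _ , y≡ = j , inj₁ y≡
  ∈-orbit⁻ {x} y∈orbit | inj₂ y∈α-powers with ∈-map⁻ _ y∈α-powers
  ...   | j , _ , y≡ = j , inj₂ y≡

  _∼?_ : Decidable _∼_
  x ∼? y = map′ ∈-orbit⁻ ∈-orbit⁺ (y ∈? orbit x)
    where open DecMembership _≟_ using (_∈?_)

  _∼ᵇ_ : X → X → Bool
  x ∼ᵇ y = isYes (x ∼? y)

  ∼⇒∼ᵇ : ∀ {x y} → x ∼ y → T (x ∼ᵇ y)
  ∼⇒∼ᵇ {x} {y} = fromWitness {a? = x ∼? y}

  ∼ᵇ⇒∼ : ∀ {x y} → T (x ∼ᵇ y) → x ∼ y
  ∼ᵇ⇒∼ {x} {y} = toWitness {a? = x ∼? y}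

  isLeast : X → Bool
  isLeast x = all (λ j → (key x ≤ᵇ key (ρ^ j x)) ∧ (key x ≤ᵇ key (α (ρ^ j x)))) (upTo N)

  isLeast⇒≤ : ∀ {x y} → T (isLeast x) → x ∼ y → key x ≤ key y
  isLeast⇒≤ {x} least x∼y with ∼-bounded x∼y
  ... | j , j<N , reach =
    bound reach (Equivalence.to (T-∧ {key x ≤ᵇ key (ρ^ j x)}) (applyUpTo⁻ _ N (all⁺ _ (upTo N) least) j<N))
    where
    bound : ∀ {y} → Reaches x y j → T (key x ≤ᵇ key (ρ^ j x)) × T (key x ≤ᵇ key (α (ρ^ j x))) → key x ≤ key y
    bound (inj₁ refl) (≤-ρ , _)   = ≤ᵇ⇒≤ _ _ ≤-ρ
    bound (inj₂ refl) (_ , ≤-α-ρ) = ≤ᵇ⇒≤ _ _ ≤-α-ρ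

  ≤⇒isLeast : ∀ {x} → (∀ {y} → x ∼ y → key x ≤ key y) → T (isLeast x)
  ≤⇒isLeast least = all⁻ _ (applyUpTo⁺₁ _ N (λ {j} _ →
    Equivalence.from T-∧ (≤⇒≤ᵇ (least (j , inj₁ refl)) , ≤⇒≤ᵇ (least (j , inj₂ refl)))))

  least-exists : ∀ y → ∃[ r ] T (isLeast r) × r ∼ y
  least-exists y = r , ≤⇒isLeast (λ r∼z → r≤orbit (∼-trans y∼r r∼z)) , ∼-sym y∼r
    where
    r = argmin key y (orbit y)
    y∼r : y ∼ r
    y∼r with argmin-sel key y (orbit y)
    ... | inj₁ r≡y     = subst (y ∼_) (sym r≡y) ∼-refl
    ... | inj₂ r∈orbit = ∈-orbit⁻ r∈orbit
    r≤orbit : ∀ {z} → y ∼ z → key r ≤ key z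
    r≤orbit y∼z = All.lookup (f[argmin]≤f[xs] y (orbit y)) (∈-orbit⁺ y∼z)

  least-unique : ∀ {x x′ y} → T (isLeast x) → T (isLeast x′) → x ∼ y → x′ ∼ y → x ≡ x′
  least-unique least least′ x∼y x′∼y = key-injective (≤-antisym
    (isLeast⇒≤ least (∼-trans x∼y (∼-sym x′∼y)))
    (isLeast⇒≤ least′ (∼-trans x′∼y (∼-sym x∼y))))

  unique-least : ∀ y → ∃[ r ] T (isLeast r) × T (r ∼ᵇ y) × (∀ x → T (isLeast x) → T (x ∼ᵇ y) → x ≡ r)
  unique-least y with least-exists y
  ... | r , least-r , r∼y = r , least-r , ∼⇒∼ᵇ r∼y ,
        λ x least-x x∼y → least-unique least-x least-r (∼ᵇ⇒∼ x∼y) r∼y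

  module OrbitCounting
    (α-fixed-point-free : ∀ x → α x ≢ x) (ε-fixed-point-free : ∀ x → ε x ≢ x)
    (ρ-fixed-point-free : ∀ x → ρ x ≢ x)
    {xs : List X} (xs! : Unique xs) (complete : ∀ x → x ∈ xs) where

    open Counting _≟_
    open Enumeration xs! complete

    orbitSize : X → ℕ
    orbitSize x = count (x ∼ᵇ_)

    ∑-orbitSize : ∑[ x ∈ xs ] 𝟙 (isLeast x) * orbitSize x ≡ length xs
    ∑-orbitSize = ∑-class-sizes isLeast _∼ᵇ_ unique-least

    orbitSize-cong : ∀ {x y} → x ∼ y → orbitSize x ≡ orbitSize y
    orbitSize-cong {x} {y} x∼y = ∑-cong xs λ z → cong 𝟙 (same z)
      where
      same : ∀ z → (x ∼ᵇ z) ≡ (y ∼ᵇ z)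
      same z with x ∼? z | y ∼? z
      ... | yes _   | yes _   = refl
      ... | no  _   | no  _   = refl
      ... | yes x∼z | no  y≁z = contradiction (∼-trans (∼-sym x∼y) x∼z) y≁z
      ... | no  x≁z | yes y∼z = contradiction (∼-trans x∼y y∼z) x≁z

    quartet : X → List X
    quartet x = x ∷ α x ∷ ρ x ∷ α (ρ x) ∷ []

    quartet-unique : ∀ x → Unique (quartet x)
    quartet-unique x =
        (≢α x ∷ ≢ρ x ∷ ≢α∘ρ ∷ [])
      ∷ (ε-fixed-point-free (α x) ∘ sym ∷ α≢α∘ρ ∷ [])
      ∷ (≢α (ρ x) ∷ [])
      ∷ [] ∷ []
      where
      ≢α : ∀ y → y ≢ α y
      ≢α y = α-fixed-point-free y ∘ sym
      ≢ρ : ∀ y → y ≢ ρ y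
      ≢ρ y = ρ-fixed-point-free y ∘ sym
      α≢α∘ρ : α x ≢ α (ρ x)
      α≢α∘ρ = ≢ρ x ∘ involutive⇒injective {g = α} α-involutive
      ≢α∘ρ : x ≢ α (ρ x)
      ≢α∘ρ x≡ = ε-fixed-point-free (α x) (sym (trans (cong α x≡) (α-involutive (ρ x))))

    quartet-in-orbit : ∀ x → All (x ∼_) (quartet x)
    quartet-in-orbit x = ∼-refl ∷ ∼-α x ∷ ∼-ρ x ∷ ∼-trans (∼-ρ x) (∼-α (ρ x)) ∷ []

    4≤orbitSize : ∀ x → 4 ≤ orbitSize x
    4≤orbitSize x = length≤count _ (quartet x) (quartet-unique x) (All.map ∼⇒∼ᵇ (quartet-in-orbit x))

    5≤orbitSize : ∀ x → ρ (ρ x) ≢ x → 5 ≤ orbitSize x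
    5≤orbitSize x ρ²x≢x = length≤count _ (ρ (ρ x) ∷ quartet x)
      ((ρ²x≢x ∷ ρ²x≢αx ∷ ρ²x≢ρx ∷ ε-fixed-point-free (α (ρ x)) ∷ []) ∷ quartet-unique x)
      (All.map ∼⇒∼ᵇ (∼-trans (∼-ρ x) (∼-ρ (ρ x)) ∷ quartet-in-orbit x))
      where
      ρ²x≢αx : ρ (ρ x) ≢ α x
      ρ²x≢αx eq = α-fixed-point-free (ρ x) (trans (sym (ε-involutive (α (ρ x)))) (cong ε eq))
      ρ²x≢ρx : ρ (ρ x) ≢ ρ x
      ρ²x≢ρx = ρ-fixed-point-free x ∘ ρ-injective

    orbitSize≤4 : (∀ x → ρ (ρ x) ≡ x) → ∀ x → orbitSize x ≤ 4
    orbitSize≤4 involutive x = count≤length _ (quartet x) (λ y x∼y → quartet-covers (∼ᵇ⇒∼ x∼y))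
      where
      ρ^-parity : ∀ j → ρ^ j x ≡ x ⊎ ρ^ j x ≡ ρ x
      ρ^-parity zero = inj₁ refl
      ρ^-parity (suc j) with ρ^-parity j
      ... | inj₁ eq = inj₂ (cong ρ eq)
      ... | inj₂ eq = inj₁ (trans (cong ρ eq) (involutive x))
      quartet-covers : ∀ {y} → x ∼ y → y ∈ quartet x
      quartet-covers (j , inj₁ refl) with ρ^-parity j
      ... | inj₁ eq = here eq
      ... | inj₂ eq = there (there (here eq))
      quartet-covers (j , inj₂ refl) with ρ^-parity j
      ... | inj₁ eq = there (here (cong α eq))
      ... | inj₂ eq = there (there (there (here (cong α eq))))

    orbitCount : ℕ
    orbitCount = count isLeast

    4*orbitCount≡∑ : 4 * orbitCount ≡ ∑[ x ∈ xs ] 𝟙 (isLeast x) * 4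
    4*orbitCount≡∑ = trans (*-distribˡ-∑ 4 xs _) (∑-cong xs (λ x → *-comm 4 (𝟙 (isLeast x))))

    4*orbitCount≤length : 4 * orbitCount ≤ length xs
    4*orbitCount≤length = begin
      4 * orbitCount                             ≡⟨ 4*orbitCount≡∑ ⟩
      (∑[ x ∈ xs ] 𝟙 (isLeast x) * 4)            ≤⟨ ∑-mono-≤ xs (λ x → *-monoʳ-≤ (𝟙 (isLeast x)) (4≤orbitSize x)) ⟩
      (∑[ x ∈ xs ] 𝟙 (isLeast x) * orbitSize x)  ≡⟨ ∑-orbitSize ⟩
      length xs                                  ∎
      where open ≤-Reasoning

    involutive⇒4*orbitCount≡length : (∀ x → ρ (ρ x) ≡ x) → 4 * orbitCount ≡ length xs
    involutive⇒4*orbitCount≡length involutive = begin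
      4 * orbitCount                             ≡⟨ 4*orbitCount≡∑ ⟩
      (∑[ x ∈ xs ] 𝟙 (isLeast x) * 4)            ≡⟨ ∑-cong xs (λ x → cong (𝟙 (isLeast x) *_) (size≡4 x)) ⟨
      (∑[ x ∈ xs ] 𝟙 (isLeast x) * orbitSize x)  ≡⟨ ∑-orbitSize ⟩
      length xs                                  ∎
      where
      open ≡-Reasoning
      size≡4 : ∀ x → orbitSize x ≡ 4
      size≡4 x = ≤-antisym (orbitSize≤4 involutive x) (4≤orbitSize x)

    4*orbitCount≡length⇒involutive : 4 * orbitCount ≡ length xs → ∀ x → ρ (ρ x) ≡ x
    4*orbitCount≡length⇒involutive 4*count≡ z with ρ (ρ z) ≟ z
    ... | yes ρ²z≡z = ρ²z≡z
    ... | no  ρ²z≢z with least-exists z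
    ...   | r , least-r , r∼z = contradiction 4*count≡ (<⇒≢ (begin-strict
      4 * orbitCount                                         <⟨ n<1+n _ ⟩
      suc (4 * orbitCount)                                   ≡⟨ +-comm 1 _ ⟩
      4 * orbitCount + 1                                     ≡⟨ cong₂ _+_ 4*orbitCount≡∑ (sym (∑-δ-∈ xs xs! (complete r))) ⟩
      (∑[ x ∈ xs ] 𝟙 (isLeast x) * 4) + (∑[ x ∈ xs ] δ r x)  ≡⟨ ∑-distrib-+ xs _ _ ⟨
      (∑[ x ∈ xs ] 𝟙 (isLeast x) * 4 + δ r x)                ≤⟨ ∑-mono-≤ xs bound ⟩
      (∑[ x ∈ xs ] 𝟙 (isLeast x) * orbitSize x)              ≡⟨ ∑-orbitSize ⟩
      length xs                                              ∎))
      where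
      open ≤-Reasoning
      bound : ∀ x → 𝟙 (isLeast x) * 4 + δ r x ≤ 𝟙 (isLeast x) * orbitSize x
      bound x with r ≟ x
      ... | no  _    = ≤-trans (≤-reflexive (+-identityʳ _)) (*-monoʳ-≤ (𝟙 (isLeast x)) (4≤orbitSize x))
      ... | yes refl = at-r (isLeast r) least-r
        where
        at-r : ∀ b → T b → 𝟙 b * 4 + 1 ≤ 𝟙 b * orbitSize r
        at-r true _ = ≤-trans (5≤orbitSize z ρ²z≢z) (≤-reflexive (trans (orbitSize-cong (∼-sym r∼z)) (sym (+-identityʳ _))))

    4*orbitCount≡length⇔involutive : 4 * orbitCount ≡ length xs ⇔ (∀ x → ρ (ρ x) ≡ x)
    4*orbitCount≡length⇔involutive = mk⇔ 4*orbitCount≡length⇒involutive involutive⇒4*orbitCount≡length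

-- The cycle of ribbon ends

halve : ∀ c → ∃[ h ] (c ≡ h + h ⊎ c ≡ suc (h + h))
halve zero    = 0 , inj₁ refl
halve (suc c) with halve c
... | h , inj₁ c≡h+h   = h , inj₂ (cong suc c≡h+h)
... | h , inj₂ c≡1+h+h = suc h , inj₁ (cong suc (trans c≡1+h+h (sym (+-suc h h))))

module _ {m : ℕ} where

  private
    M = suc m

  toℕ-shift : ∀ (p : Fin M) j → toℕ (shift p j) ≡ (toℕ p + j) % M
  toℕ-shift p zero    = sym (trans (cong (_% M) (+-identityʳ (toℕ p))) (m<n⇒m%n≡m (toℕ<n p)))
  toℕ-shift p (suc j) = begin
    toℕ (next (shift p j))             ≡⟨ toℕ-fromℕ< _ ⟩
    suc (toℕ (shift p j)) % M          ≡⟨ cong (λ a → suc a % M) (toℕ-shift p j) ⟩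
    (1 + (toℕ p + j) % M) % M          ≡⟨ %-distribˡ-+ 1 _ M ⟩
    (1 % M + (toℕ p + j) % M % M) % M  ≡⟨ cong (λ a → (1 % M + a) % M) (m%n%n≡m%n (toℕ p + j) M) ⟩
    (1 % M + (toℕ p + j) % M) % M      ≡⟨ %-distribˡ-+ 1 (toℕ p + j) M ⟨
    (1 + (toℕ p + j)) % M              ≡⟨ cong (_% M) (sym (+-suc (toℕ p) j)) ⟩
    (toℕ p + suc j) % M                ∎
    where open ≡-Reasoning

  toℕ-shift-zero : ∀ {j} → j < M → toℕ (shift zero j) ≡ j
  toℕ-shift-zero {j} j<M = trans (toℕ-shift zero j) (m<n⇒m%n≡m j<M)

  shift-zero-toℕ : ∀ (p : Fin M) → shift zero (toℕ p) ≡ p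
  shift-zero-toℕ p = toℕ-injective (toℕ-shift-zero (toℕ<n p))

  shift-+ : ∀ (p : Fin M) i j → shift (shift p i) j ≡ shift p (i + j)
  shift-+ p i zero    = cong (shift p) (sym (+-identityʳ i))
  shift-+ p i (suc j) = trans (cong next (shift-+ p i j)) (cong (shift p) (sym (+-suc i j)))

  shift-comm : ∀ (p : Fin M) i j → shift (shift p i) j ≡ shift (shift p j) i
  shift-comm p i j = trans (shift-+ p i j) (trans (cong (shift p) (+-comm i j)) (sym (shift-+ p j i)))

  shift-toℕ-comm : ∀ (p q : Fin M) → shift p (toℕ q) ≡ shift q (toℕ p)
  shift-toℕ-comm p q = begin
    shift p (toℕ q)                     ≡⟨ cong (λ r → shift r (toℕ q)) (shift-zero-toℕ p) ⟨
    shift (shift zero (toℕ p)) (toℕ q)  ≡⟨ shift-comm zero (toℕ p) (toℕ q) ⟩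
    shift (shift zero (toℕ q)) (toℕ p)  ≡⟨ cong (λ r → shift r (toℕ p)) (shift-zero-toℕ q) ⟩
    shift q (toℕ p)                     ∎
    where open ≡-Reasoning

  shift-period : ∀ (p : Fin M) → shift p M ≡ p
  shift-period p = toℕ-injective (begin
    toℕ (shift p M)  ≡⟨ toℕ-shift p M ⟩
    (toℕ p + M) % M  ≡⟨ [m+n]%n≡m%n (toℕ p) M ⟩
    toℕ p % M        ≡⟨ m<n⇒m%n≡m (toℕ<n p) ⟩
    toℕ p            ∎)
    where open ≡-Reasoning

  shift-*-period : ∀ (p : Fin M) k → shift p (k * M) ≡ p
  shift-*-period p zero    = refl
  shift-*-period p (suc k) = begin
    shift p (M + k * M)          ≡⟨ shift-+ p M (k * M) ⟨
    shift (shift p M) (k * M)    ≡⟨ cong (λ q → shift q (k * M)) (shift-period p) ⟩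
    shift p (k * M)              ≡⟨ shift-*-period p k ⟩
    p                            ∎
    where open ≡-Reasoning

  prev≡shift : ∀ (p : Fin M) → prev p ≡ shift p m
  prev≡shift p = toℕ-injective (trans (toℕ-fromℕ< _) (sym (toℕ-shift p m)))

  next-prev : ∀ (p : Fin M) → next (prev p) ≡ p
  next-prev p = trans (cong next (prev≡shift p)) (shift-period p)

  prev-next : ∀ (p : Fin M) → prev (next p) ≡ p
  prev-next p = trans (prev≡shift (next p)) (trans (shift-+ p 1 m) (shift-period p))

  next-injective : ∀ {p q : Fin M} → next p ≡ next q → p ≡ q
  next-injective {p} {q} eq = trans (sym (prev-next p)) (trans (cong prev eq) (prev-next q))

  shift-injective : ∀ j {p q : Fin M} → shift p j ≡ shift q j → p ≡ q
  shift-injective zero    eq = eq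
  shift-injective (suc j) eq = shift-injective j (next-injective eq)

  shift-next : ∀ (p : Fin M) j → shift (next p) j ≡ next (shift p j)
  shift-next p zero    = refl
  shift-next p (suc j) = cong next (shift-next p j)

  shift≡self⇒≡0 : ∀ {j} (p : Fin M) → j < M → shift p j ≡ p → j ≡ 0
  shift≡self⇒≡0 {j} p j<M eq = trans (sym (toℕ-shift-zero j<M)) (cong toℕ (shift-injective (toℕ p) (begin
    shift (shift zero j) (toℕ p)  ≡⟨ shift-comm zero j (toℕ p) ⟩
    shift (shift zero (toℕ p)) j  ≡⟨ cong (λ q → shift q j) (shift-zero-toℕ p) ⟩
    shift p j                     ≡⟨ eq ⟩
    p                             ≡⟨ shift-zero-toℕ p ⟨
    shift zero (toℕ p)            ∎)))
    where open ≡-Reasoning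

  shift-zero≡zero : ∀ {j} → j < M + M → shift zero j ≡ zero → j ≡ 0 ⊎ j ≡ M
  shift-zero≡zero {j} j<2M eq with j <? M
  ... | yes j<M = inj₁ (shift≡self⇒≡0 zero j<M eq)
  ... | no  j≮M = inj₂ (begin
    j            ≡⟨ M+d≡j ⟨
    M + (j ∸ M)  ≡⟨ cong (M +_) (shift≡self⇒≡0 zero d<M shift-d) ⟩
    M + 0        ≡⟨ +-identityʳ M ⟩
    M            ∎)
    where
    open ≡-Reasoning
    M+d≡j : M + (j ∸ M) ≡ j
    M+d≡j = m+[n∸m]≡n (≮⇒≥ j≮M)
    d<M : j ∸ M < M
    d<M = +-cancelˡ-< M _ _ (subst (_< M + M) (sym M+d≡j) j<2M)
    shift-d : shift zero (j ∸ M) ≡ zero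
    shift-d = begin
      shift zero (j ∸ M)            ≡⟨ cong (λ q → shift q (j ∸ M)) (shift-period zero) ⟨
      shift (shift zero M) (j ∸ M)  ≡⟨ shift-+ zero M (j ∸ M) ⟩
      shift zero (M + (j ∸ M))      ≡⟨ cong (shift zero) M+d≡j ⟩
      shift zero j                  ≡⟨ eq ⟩
      zero                          ∎

  next-increments-or-wraps : ∀ (p : Fin M) → toℕ (next p) ≡ suc (toℕ p) ⊎ (toℕ (next p) ≡ 0 × suc (toℕ p) ≡ M)
  next-increments-or-wraps p with suc (toℕ p) <? M
  ... | yes p+1<M = inj₁ (trans (toℕ-fromℕ< _) (m<n⇒m%n≡m p+1<M))
  ... | no  p+1≮M = inj₂ (trans (toℕ-fromℕ< _) (trans (cong (_% M) p+1≡M) (n%n≡0 M)) , p+1≡M)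
    where
    p+1≡M : suc (toℕ p) ≡ M
    p+1≡M = ≤-antisym (toℕ<n p) (≮⇒≥ p+1≮M)

  shift-onto : ∀ (r p : Fin M) → ∃[ q ] shift r (toℕ q) ≡ p
  shift-onto r p = shift p (M ∸ toℕ r) , (begin
    shift r (toℕ (shift p (M ∸ toℕ r)))  ≡⟨ shift-toℕ-comm r _ ⟩
    shift (shift p (M ∸ toℕ r)) (toℕ r)  ≡⟨ shift-+ p (M ∸ toℕ r) (toℕ r) ⟩
    shift p (M ∸ toℕ r + toℕ r)          ≡⟨ cong (shift p) (m∸n+n≡m (<⇒≤ (toℕ<n r))) ⟩
    shift p M                            ≡⟨ shift-period p ⟩
    p                                    ∎)
    where open ≡-Reasoning

  glide : Bool → Fin M → Fin M
  glide true  = next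
  glide false = prev

  invariant-along-next : {A : Set} (g : Fin M → A) → (∀ p → g (next p) ≡ g p) → ∀ p → g p ≡ g zero
  invariant-along-next g g-next p = trans (cong g (sym (shift-zero-toℕ p))) (along (toℕ p))
    where
    along : ∀ j → g (shift zero j) ≡ g zero
    along zero    = refl
    along (suc j) = trans (g-next (shift zero j)) (along j)

  module _ (π : Fin M → Fin M) where

    rotation≡shift : (∀ p → π (next p) ≡ next (π p)) → ∀ p → π p ≡ shift p (toℕ (π zero))
    rotation≡shift π-next p = begin
      π p                     ≡⟨ cong π (shift-zero-toℕ p) ⟨
      π (shift zero (toℕ p))  ≡⟨ along (toℕ p) ⟩
      shift (π zero) (toℕ p)  ≡⟨ shift-toℕ-comm (π zero) p ⟩
      shift p (toℕ (π zero))  ∎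
      where
      open ≡-Reasoning
      along : ∀ j → π (shift zero j) ≡ shift (π zero) j
      along zero    = refl
      along (suc j) = trans (π-next (shift zero j)) (cong next (along j))

    involutive-rotation-is-half-turn : (∀ p → π (next p) ≡ next (π p)) → (∀ p → π (π p) ≡ p) → π zero ≢ zero →
      toℕ (π zero) + toℕ (π zero) ≡ M
    involutive-rotation-is-half-turn π-next π-involutive π0≢0 with shift-zero≡zero (+-mono-< (toℕ<n c) (toℕ<n c)) c-twice
      where
      c = π zero
      c-twice : shift zero (toℕ c + toℕ c) ≡ zero
      c-twice = begin
        shift zero (toℕ c + toℕ c)          ≡⟨ shift-+ zero (toℕ c) (toℕ c) ⟨
        shift (shift zero (toℕ c)) (toℕ c)  ≡⟨ cong (λ q → shift q (toℕ c)) (shift-zero-toℕ c) ⟩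
        shift c (toℕ c)                     ≡⟨ rotation≡shift π-next c ⟨
        π c                                 ≡⟨ π-involutive zero ⟩
        zero                                ∎
        where open ≡-Reasoning
    ... | inj₁ 2c≡0 = contradiction (toℕ-injective (m+n≡0⇒m≡0 _ 2c≡0)) π0≢0
    ... | inj₂ 2c≡M = 2c≡M

    -- π runs backwards, π h = π 0 − h, so π fixes h or swaps h and h + 1 according as
    -- π 0 = 2h or 2h + 1.
    reflection-fixes-or-swaps-adjacent : (∀ p → π (next p) ≡ prev (π p)) → ∃[ p ] (π p ≡ p ⊎ π p ≡ next p)
    reflection-fixes-or-swaps-adjacent π-next = fixes-or-swaps (halve (toℕ (π zero)))
      where
      along : ∀ j → π (shift zero j) ≡ shift (π zero) (j * m)
      along zero    = refl
      along (suc j) = begin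
        π (next (shift zero j))           ≡⟨ π-next (shift zero j) ⟩
        prev (π (shift zero j))           ≡⟨ cong prev (along j) ⟩
        prev (shift (π zero) (j * m))     ≡⟨ prev≡shift _ ⟩
        shift (shift (π zero) (j * m)) m  ≡⟨ shift-+ (π zero) (j * m) m ⟩
        shift (π zero) (j * m + m)        ≡⟨ cong (shift (π zero)) (+-comm (j * m) m) ⟩
        shift (π zero) (suc j * m)        ∎
        where open ≡-Reasoning
      regroup : ∀ e h → e + (h + h) + h * m ≡ e + h + h * M
      regroup e h = solve 3 (λ e h m → e :+ (h :+ h) :+ h :* m := e :+ h :+ h :* (con 1 :+ m)) refl e h m
      landing : ∀ h e → toℕ (π zero) ≡ e + (h + h) → π (shift zero h) ≡ shift zero (e + h)
      landing h e C≡ = begin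
        π (shift zero h)                           ≡⟨ along h ⟩
        shift (π zero) (h * m)                     ≡⟨ cong (λ q → shift q (h * m)) (shift-zero-toℕ (π zero)) ⟨
        shift (shift zero (toℕ (π zero))) (h * m)  ≡⟨ shift-+ zero (toℕ (π zero)) (h * m) ⟩
        shift zero (toℕ (π zero) + h * m)          ≡⟨ cong (λ c → shift zero (c + h * m)) C≡ ⟩
        shift zero (e + (h + h) + h * m)           ≡⟨ cong (shift zero) (regroup e h) ⟩
        shift zero (e + h + h * M)                 ≡⟨ shift-+ zero (e + h) (h * M) ⟨
        shift (shift zero (e + h)) (h * M)         ≡⟨ shift-*-period (shift zero (e + h)) h ⟩
        shift zero (e + h)                         ∎
        where open ≡-Reasoning
      fixes-or-swaps : ∃[ h ] (toℕ (π zero) ≡ h + h ⊎ toℕ (π zero) ≡ suc (h + h)) → ∃[ p ] (π p ≡ p ⊎ π p ≡ next p)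
      fixes-or-swaps (h , inj₁ C≡h+h)   = shift zero h , inj₁ (landing h 0 C≡h+h)
      fixes-or-swaps (h , inj₂ C≡1+h+h) = shift zero h , inj₂ (landing h 1 C≡1+h+h)

-- Boundary components as orbits

_≟-side_ : DecidableEquality Side
L ≟-side L = yes refl
L ≟-side R = no λ ()
R ≟-side L = no λ ()
R ≟-side R = yes refl

concatMap-sides≡cartesianProduct : {A : Set} (ps : List A) →
  concatMap (λ p → (p , L) ∷ (p , R) ∷ []) ps ≡ cartesianProduct ps (L ∷ R ∷ [])
concatMap-sides≡cartesianProduct []       = refl
concatMap-sides≡cartesianProduct (p ∷ ps) = cong (λ qs → (p , L) ∷ (p , R) ∷ qs) (concatMap-sides≡cartesianProduct ps)

length-concatMap-sides : {A : Set} (ps : List A) →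
  length (concatMap (λ p → (p , L) ∷ (p , R) ∷ []) ps) ≡ 2 * length ps
length-concatMap-sides []       = refl
length-concatMap-sides (p ∷ ps) = cong suc (trans (cong suc (length-concatMap-sides ps)) (sym (+-suc _ _)))

module _ (n : ℕ) where

  allNodes-unique : Unique (allNodes n)
  allNodes-unique = subst Unique (sym (concatMap-sides≡cartesianProduct (allFin (2 * n))))
    (cartesianProduct⁺ (allFin⁺ (2 * n)) (((λ ()) ∷ []) ∷ [] ∷ []))

  ∈-allNodes : ∀ x → x ∈ allNodes n
  ∈-allNodes (p , s) = subst ((p , s) ∈_) (sym (concatMap-sides≡cartesianProduct (allFin (2 * n))))
    (∈-cartesianProduct⁺ (∈-allFin p) (side∈ s))
    where
    side∈ : ∀ s → s ∈ L ∷ R ∷ []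
    side∈ L = here refl
    side∈ R = there (here refl)

  length-allNodes : length (allNodes n) ≡ 4 * n
  length-allNodes = begin
    length (allNodes n)          ≡⟨ length-concatMap-sides (allFin (2 * n)) ⟩
    2 * length (allFin (2 * n))  ≡⟨ cong (2 *_) (length-tabulate {n = 2 * n} (λ p → p)) ⟩
    2 * (2 * n)                  ≡⟨ *-assoc 2 2 n ⟨
    4 * n                        ∎
    where open ≡-Reasoning

  key-injective : ∀ {x y : Node n} → key {n} x ≡ key {n} y → x ≡ y
  key-injective {p , L} {q , L} eq = cong (_, L) (toℕ-injective (*-cancelˡ-≡ _ _ 2 eq))
  key-injective {p , L} {q , R} eq = contradiction eq (even≢odd (toℕ p) (toℕ q))
  key-injective {p , R} {q , L} eq = contradiction (sym eq) (even≢odd (toℕ q) (toℕ p))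
  key-injective {p , R} {q , R} eq = cong (_, R) (toℕ-injective (*-cancelˡ-≡ _ _ 2 (suc-injective eq)))

  key<4n : ∀ (x : Node n) → key {n} x < 4 * n
  key<4n (p , s) = ≤-trans (key<2[1+p] s) (≤-trans (*-monoʳ-≤ 2 (toℕ<n p)) (≤-reflexive (sym (*-assoc 2 2 n))))
    where
    key<2[1+p] : ∀ s → key {n} (p , s) < 2 * suc (toℕ p)
    key<2[1+p] L = s≤s (+-monoʳ-≤ (toℕ p) (n≤1+n _))
    key<2[1+p] R = ≤-reflexive (cong suc (sym (+-suc (toℕ p) (toℕ p + 0))))

sideAcross : Bool → Side → Side
sideAcross b s = if b then s else flipSide s

sideAcross-involutive : ∀ b s → sideAcross b (sideAcross b s) ≡ s
sideAcross-involutive true  s = refl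
sideAcross-involutive false L = refl
sideAcross-involutive false R = refl

sideAcross-R≡R : ∀ {b} → sideAcross b R ≡ R → b ≡ true
sideAcross-R≡R {true} _ = refl

sideAcross-L≡R : ∀ {b} → sideAcross b L ≡ R → b ≡ false
sideAcross-L≡R {false} _ = refl

module _ {k : ℕ} (B : Bouquet (suc k)) where

  private
    n = suc k

  α : Node n → Node n
  α = arcα {n}

  ε : Node n → Node n
  ε = edgeε B

  α-involutive : ∀ x → α (α x) ≡ x
  α-involutive (p , L) = cong (_, L) (next-prev p)
  α-involutive (p , R) = cong (_, R) (prev-next p)

  α-fixed-point-free : ∀ x → α x ≢ x
  α-fixed-point-free (p , L) ()
  α-fixed-point-free (p , R) ()

  twisted-partner : ∀ p → twisted B (partner B p) ≡ twisted B p
  twisted-partner p = trans (cong (λ q → sgn B (partner B p) xor sgn B q) (partner-inv B p))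
                            (xor-comm (sgn B (partner B p)) (sgn B p))

  ε-involutive : ∀ x → ε (ε x) ≡ x
  ε-involutive (p , s) = cong₂ _,_ (partner-inv B p)
    (trans (cong (λ b → sideAcross b (sideAcross (twisted B p) s)) (twisted-partner p))
           (sideAcross-involutive (twisted B p) s))

  ε-fixed-point-free : ∀ x → ε x ≢ x
  ε-fixed-point-free (p , s) eq = partner-ne B p (cong proj₁ eq)

  _≟-node_ : DecidableEquality (Node n)
  _≟-node_ = ≡-dec _≟-fin_ _≟-side_

  open TwoInvolutions _≟-node_ α ε α-involutive ε-involutive (key {n}) (key<4n n) (key-injective n)

  stepIter≡ρ^ : ∀ j x → stepIter B j x ≡ ρ^ j x
  stepIter≡ρ^ zero    x = refl
  stepIter≡ρ^ (suc j) x = cong (step B) (stepIter≡ρ^ j x)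

  isRep≡isLeast : ∀ x → isRep B x ≡ isLeast x
  isRep≡isLeast x = cong and (map-cong (λ j → cong least-at (stepIter≡ρ^ j x)) (upTo (4 * n)))
    where
    least-at : Node n → Bool
    least-at y = (key {n} x ≤ᵇ key {n} y) ∧ (key {n} x ≤ᵇ key {n} (α y))

  step-fixed⇒adjacent-ends : ∀ x → step B x ≡ x → ∃[ q ] partner B q ≡ next q
  step-fixed⇒adjacent-ends (p , R) eq = p , trans (cong (partner B) (sym (cong proj₁ eq))) (partner-inv B (next p))
  step-fixed⇒adjacent-ends (p , L) eq = prev p , trans (cong proj₁ eq) (sym (next-prev p))

  module _ (no-adjacent-ends : ∀ q → partner B q ≢ next q) where

    step-fixed-point-free : ∀ x → step B x ≢ x
    step-fixed-point-free x eq with step-fixed⇒adjacent-ends x eq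
    ... | q , adjacent = no-adjacent-ends q adjacent

    open OrbitCounting α-fixed-point-free ε-fixed-point-free step-fixed-point-free (allNodes-unique n) (∈-allNodes n)

    f≡orbitCount : f B ≡ orbitCount
    f≡orbitCount = ∑-cong (allNodes n) (λ x → cong 𝟙 (isRep≡isLeast x))

    f≡n⇔4*orbitCount≡length : f B ≡ n ⇔ 4 * orbitCount ≡ length (allNodes n)
    f≡n⇔4*orbitCount≡length = mk⇔
      (λ f≡n → trans (cong (4 *_) (trans (sym f≡orbitCount) f≡n)) (sym (length-allNodes n)))
      (λ 4c≡ → trans f≡orbitCount (*-cancelˡ-≡ _ n 4 (trans 4c≡ (length-allNodes n))))

    faces≤edges : f B ≤ n
    faces≤edges = *-cancelˡ-≤ 4 (begin
      4 * f B              ≡⟨ cong (4 *_) f≡orbitCount ⟩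
      4 * orbitCount       ≤⟨ 4*orbitCount≤length ⟩
      length (allNodes n)  ≡⟨ length-allNodes n ⟩
      4 * n                ∎)
      where open ≤-Reasoning

    faces≡edges⇔step-involutive : f B ≡ n ⇔ (∀ x → step B (step B x) ≡ x)
    faces≡edges⇔step-involutive = ⇔.trans f≡n⇔4*orbitCount≡length 4*orbitCount≡length⇔involutive

-- Loops with adjacent ends

module _ {k : ℕ} (B : Bouquet (suc k)) where

  between-same-loop : ∀ {p q x} → lab B p ≡ lab B q →
    StrictlyBetween p (partner B p) x → StrictlyBetween q (partner B q) x
  between-same-loop {p} {q} {x} same between with two-ends B q p (sym same)
  ... | inj₁ refl = between
  ... | inj₂ refl = Data.Sum.swap (subst (λ r → StrictlyBetween (partner B q) r x) (partner-inv B q) between)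

  -- StrictlyBetween compares positions as numbers: between the wrapping pair of ends
  -- (2n − 1, 0) lie all other positions, between any other consecutive pair none.
  between-adjacent-ends : ∀ {q c} → partner B q ≡ next q →
    StrictlyBetween q (next q) c → StrictlyBetween q (next q) (partner B c)
  between-adjacent-ends {q} {c} adjacent between with next-increments-or-wraps q | between
  ... | inj₁ q+1≡ | inj₁ (q<c , c<q+1) = contradiction (≤-pred (subst (toℕ c <_) q+1≡ c<q+1)) (<⇒≱ q<c)
  ... | inj₁ q+1≡ | inj₂ (q+1<c , c<q) = contradiction (<-trans (n<1+n (toℕ q)) (subst (_< toℕ c) q+1≡ q+1<c)) (<-asym c<q)
  ... | inj₂ (wraps , _)     | inj₁ (_ , c<0)      = contradiction (subst (toℕ c <_) wraps c<0) n≮0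
  ... | inj₂ (wraps , q+1≡M) | inj₂ (0<c , c<q)    = inj₂ (0<c′ , c′<q)
    where
    c′≢q : partner B c ≢ q
    c′≢q c′≡q = <-irrefl (cong toℕ (sym c≡next)) 0<c
      where
      c≡next : c ≡ next q
      c≡next = trans (sym (partner-inv B c)) (trans (cong (partner B) c′≡q) adjacent)
    c′≢next : partner B c ≢ next q
    c′≢next c′≡next = <-irrefl (cong toℕ c≡q) c<q
      where
      c≡q : c ≡ q
      c≡q = begin
        c                        ≡⟨ partner-inv B c ⟨
        partner B (partner B c)  ≡⟨ cong (partner B) c′≡next ⟩
        partner B (next q)       ≡⟨ cong (partner B) adjacent ⟨
        partner B (partner B q)  ≡⟨ partner-inv B q ⟩
        q                        ∎
        where open ≡-Reasoning
    0<c′ : toℕ (next q) < toℕ (partner B c)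
    0<c′ = subst (_< toℕ (partner B c)) (sym wraps)
      (n≢0⇒n>0 λ c′≡0 → c′≢next (toℕ-injective (trans c′≡0 (sym wraps))))
    c′<q : toℕ (partner B c) < toℕ q
    c′<q = ≤∧≢⇒< (≤-pred (subst (toℕ (partner B c) <_) (sym q+1≡M) (toℕ<n (partner B c)))) (c′≢q ∘ toℕ-injective)

  adjacent-ends-not-interlaced : ∀ {q e} → partner B q ≡ next q → ¬ Interlaced B (lab B q) e
  adjacent-ends-not-interlaced {q} adjacent (p , c , p∈q , _ , between , ¬between′) =
    ¬between′ (between-same-loop (sym p∈q) (subst (λ r → StrictlyBetween q r (partner B c)) (sym adjacent)
      (between-adjacent-ends adjacent (subst (λ r → StrictlyBetween q r c) adjacent (between-same-loop p∈q between)))))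

first-step : ∀ {A : Set} {R : A → A → Set} {a b} → a ≢ b → Star R a b → ∃[ c ] R a c
first-step a≢b Star.ε        = contradiction refl a≢b
first-step _   (a→c Star.◅ _) = _ , a→c

another : ∀ {k} (i : Fin (suc (suc k))) → ∃[ j ] i ≢ j
another zero    = suc zero , λ ()
another (suc _) = zero , λ ()

prime⇒no-adjacent-ends : ∀ {k} (B : Bouquet (suc (suc k))) → Prime B → ∀ q → partner B q ≢ next q
prime⇒no-adjacent-ends B prime q adjacent with another (lab B q)
... | e , e≢ with first-step e≢ (prime (lab B q) e)
...   | _ , interlaced = adjacent-ends-not-interlaced B adjacent interlaced

-- Antipodal bouquets

xor≡false⇒≡ : ∀ {a b} → a xor b ≡ false → a ≡ b
xor≡false⇒≡ {true}  {true}  _ = refl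
xor≡false⇒≡ {false} {false} _ = refl

xor≡true⇒≡not : ∀ {a b} → a xor b ≡ true → b ≡ not a
xor≡true⇒≡not {true}  {false} _ = refl
xor≡true⇒≡not {false} {true}  _ = refl

module _ {k : ℕ} (B : Bouquet (suc k)) where

  private
    n = suc k

    n+n≡2n : n + n ≡ 2 * n
    n+n≡2n = cong (n +_) (sym (+-identityʳ n))

    n+i<2n : ∀ {i} → i < n → n + i < 2 * n
    n+i<2n {i} i<n = subst (n + i <_) n+n≡2n (+-monoʳ-< n i<n)

  record Antipodal : Set where
    field
      all-twisted   : ∀ p → twisted B p ≡ true
      partner≡shift : ∀ p → partner B p ≡ shift p n

  antipodal⇒step-involutive : Antipodal → ∀ x → step B (step B x) ≡ x
  antipodal⇒step-involutive antipodal = involutive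
    where
    open Antipodal antipodal
    open ≡-Reasoning
    partner-next : ∀ p → partner B (next p) ≡ next (partner B p)
    partner-next p = begin
      partner B (next p)  ≡⟨ partner≡shift (next p) ⟩
      shift (next p) n    ≡⟨ shift-next p n ⟩
      next (shift p n)    ≡⟨ cong next (partner≡shift p) ⟨
      next (partner B p)  ∎
    partner-prev : ∀ p → partner B (prev p) ≡ prev (partner B p)
    partner-prev p = begin
      partner B (prev p)                ≡⟨ prev-next _ ⟨
      prev (next (partner B (prev p)))  ≡⟨ cong prev (partner-next (prev p)) ⟨
      prev (partner B (next (prev p)))  ≡⟨ cong (prev ∘ partner B) (next-prev p) ⟩
      prev (partner B p)                ∎
    involutive : ∀ x → step B (step B x) ≡ x
    involutive (p , R) = begin
      step B (partner B (next p) , sideAcross (twisted B (next p)) L)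
        ≡⟨ cong (λ b → step B (partner B (next p) , sideAcross b L)) (all-twisted (next p)) ⟩
      (partner B (prev (partner B (next p))) , sideAcross (twisted B (prev (partner B (next p)))) R)
        ≡⟨ cong₂ _,_ (partner-prev _) (cong (λ b → sideAcross b R) (all-twisted _)) ⟩
      (prev (partner B (partner B (next p))) , R)  ≡⟨ cong (λ q → prev q , R) (partner-inv B (next p)) ⟩
      (prev (next p) , R)                          ≡⟨ cong (_, R) (prev-next p) ⟩
      (p , R)                                      ∎
    involutive (p , L) = begin
      step B (partner B (prev p) , sideAcross (twisted B (prev p)) R)
        ≡⟨ cong (λ b → step B (partner B (prev p) , sideAcross b R)) (all-twisted (prev p)) ⟩
      (partner B (next (partner B (prev p))) , sideAcross (twisted B (next (partner B (prev p)))) L)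
        ≡⟨ cong₂ _,_ (partner-next _) (cong (λ b → sideAcross b L) (all-twisted _)) ⟩
      (next (partner B (partner B (prev p))) , L)  ≡⟨ cong (λ q → next q , L) (partner-inv B (prev p)) ⟩
      (next (prev p) , L)                          ≡⟨ cong (_, L) (next-prev p) ⟩
      (p , L)                                      ∎

  module _ (involutive : ∀ x → step B (step B x) ≡ x) where

    twist-and-partner-along-next : ∀ p →
      twisted B (next p) ≡ twisted B p × partner B (next p) ≡ glide (twisted B p) (partner B p)
    twist-and-partner-along-next p with twisted B (next p) in twisted-next
    ... | true  = sym p-twisted , subst (λ b → q ≡ glide b (partner B p)) (sym p-twisted) q≡next
      where
      q = partner B (next p)
      back : step B (q , L) ≡ (p , R)
      back = trans (cong (λ b → step B (q , sideAcross b L)) (sym twisted-next)) (involutive (p , R))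
      prev-q : prev q ≡ partner B p
      prev-q = trans (sym (partner-inv B (prev q))) (cong (partner B ∘ proj₁) back)
      q≡next : q ≡ next (partner B p)
      q≡next = trans (sym (next-prev q)) (cong next prev-q)
      p-twisted : twisted B p ≡ true
      p-twisted = trans (sym (twisted-partner B p))
                        (trans (cong (twisted B) (sym prev-q)) (sideAcross-R≡R (cong proj₂ back)))
    ... | false = sym p-untwisted , subst (λ b → q ≡ glide b (partner B p)) (sym p-untwisted) q≡prev
      where
      q = partner B (next p)
      back : step B (q , R) ≡ (p , R)
      back = trans (cong (λ b → step B (q , sideAcross b L)) (sym twisted-next)) (involutive (p , R))
      next-q : next q ≡ partner B p
      next-q = trans (sym (partner-inv B (next q))) (cong (partner B ∘ proj₁) back)
      q≡prev : q ≡ prev (partner B p)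
      q≡prev = trans (sym (prev-next q)) (cong prev next-q)
      p-untwisted : twisted B p ≡ false
      p-untwisted = trans (sym (twisted-partner B p))
                          (trans (cong (twisted B) (sym next-q)) (sideAcross-L≡R (cong proj₂ back)))

    twisted-constant : ∀ p → twisted B p ≡ twisted B zero
    twisted-constant = invariant-along-next (twisted B) (proj₁ ∘ twist-and-partner-along-next)

    partner-next-glides : ∀ p → partner B (next p) ≡ glide (twisted B zero) (partner B p)
    partner-next-glides p =
      trans (proj₂ (twist-and-partner-along-next p)) (cong (λ b → glide b (partner B p)) (twisted-constant p))

    step-involutive⇒antipodal : (∀ q → partner B q ≢ next q) → Antipodal
    step-involutive⇒antipodal no-adjacent-ends with twisted B zero in twisted-zero
    ... | false = contradiction (reflection-fixes-or-swaps-adjacent (partner B) partner-next) no-fixed-or-adjacent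
      where
      partner-next : ∀ p → partner B (next p) ≡ prev (partner B p)
      partner-next p = trans (partner-next-glides p) (cong (λ b → glide b (partner B p)) twisted-zero)
      no-fixed-or-adjacent : ¬ (∃[ p ] (partner B p ≡ p ⊎ partner B p ≡ next p))
      no-fixed-or-adjacent (p , inj₁ fixed)    = partner-ne B p fixed
      no-fixed-or-adjacent (p , inj₂ adjacent) = no-adjacent-ends p adjacent
    ... | true  = record
      { all-twisted   = λ p → trans (twisted-constant p) twisted-zero
      ; partner≡shift = λ p → trans (rotation≡shift (partner B) partner-next p) (cong (shift p) C≡n)
      }
      where
      partner-next : ∀ p → partner B (next p) ≡ next (partner B p)
      partner-next p = trans (partner-next-glides p) (cong (λ b → glide b (partner B p)) twisted-zero)
      C≡n : toℕ (partner B zero) ≡ n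
      C≡n = *-cancelˡ-≡ _ n 2 (trans (cong (toℕ (partner B zero) +_) (+-identityʳ _))
              (involutive-rotation-is-half-turn (partner B) partner-next (partner-inv B) (partner-ne B zero)))

  standard⇒antipodal : HasStandardRotation B → Antipodal
  standard⇒antipodal (r , π , rev , reads) = record { all-twisted = all-twisted ; partner≡shift = partner≡shift }
    where
    a b : Fin n → Fin (2 * n)
    a i = shift r (toℕ i)
    b i = shift r (n + toℕ i)

    b≡shift-a : ∀ i → b i ≡ shift (a i) n
    b≡shift-a i = trans (cong (shift r) (+-comm n (toℕ i))) (sym (shift-+ r (toℕ i) n))

    partner-a : ∀ i → partner B (a i) ≡ b i
    partner-a i with reads i
    ... | lab-a , _ , lab-b , _ with two-ends B (a i) (b i) (trans lab-a (sym lab-b))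
    ...   | inj₁ b≡a       = contradiction (shift≡self⇒≡0 (a i) (m<m+n n (s≤s z≤n)) (trans (sym (b≡shift-a i)) b≡a)) λ ()
    ...   | inj₂ b≡partner = sym b≡partner

    twisted-a : ∀ i → twisted B (a i) ≡ true
    twisted-a i with reads i
    ... | _ , a-sign , _ , b-sign = begin
      sgn B (a i) xor sgn B (partner B (a i))  ≡⟨ cong (λ q → sgn B (a i) xor sgn B q) (partner-a i) ⟩
      sgn B (a i) xor sgn B (b i)              ≡⟨ cong (sgn B (a i) xor_) (xor≡false⇒≡ b-sign) ⟩
      sgn B (a i) xor rev (π i)                ≡⟨ a-sign ⟩
      true                                     ∎
      where open ≡-Reasoning

    cover : ∀ p → ∃[ i ] (p ≡ a i ⊎ p ≡ b i)
    cover p with shift-onto r p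
    ... | q , r+q≡p with toℕ q <? n
    ...   | yes q<n = fromℕ< q<n , inj₁ (trans (sym r+q≡p) (cong (shift r) (sym (toℕ-fromℕ< q<n))))
    ...   | no  q≮n = fromℕ< d<n , inj₂ (trans (sym r+q≡p) (cong (shift r) (begin
      toℕ q                      ≡⟨ n+d≡q ⟨
      n + (toℕ q ∸ n)            ≡⟨ cong (n +_) (toℕ-fromℕ< d<n) ⟨
      n + toℕ (fromℕ< d<n)       ∎)))
      where
      open ≡-Reasoning
      n+d≡q : n + (toℕ q ∸ n) ≡ toℕ q
      n+d≡q = m+[n∸m]≡n (≮⇒≥ q≮n)
      d<n : toℕ q ∸ n < n
      d<n = +-cancelˡ-< n _ _ (subst₂ _<_ (sym n+d≡q) (sym n+n≡2n) (toℕ<n q))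

    partner≡shift : ∀ p → partner B p ≡ shift p n
    partner≡shift p with cover p
    ... | i , inj₁ refl = trans (partner-a i) (b≡shift-a i)
    ... | i , inj₂ refl = begin
      partner B (b i)              ≡⟨ cong (partner B) (partner-a i) ⟨
      partner B (partner B (a i))  ≡⟨ partner-inv B (a i) ⟩
      a i                          ≡⟨ shift-period (a i) ⟨
      shift (a i) (2 * n)          ≡⟨ cong (shift (a i)) n+n≡2n ⟨
      shift (a i) (n + n)          ≡⟨ shift-+ (a i) n n ⟨
      shift (shift (a i) n) n      ≡⟨ cong (λ q → shift q n) (b≡shift-a i) ⟨
      shift (b i) n                ∎
      where open ≡-Reasoning

    all-twisted : ∀ p → twisted B p ≡ true
    all-twisted p with cover p
    ... | i , inj₁ refl = twisted-a i
    ... | i , inj₂ refl = trans (cong (twisted B) (sym (partner-a i))) (trans (twisted-partner B (a i)) (twisted-a i))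

  antipodal⇒standard : Antipodal → HasStandardRotation B
  antipodal⇒standard antipodal = zero , π , rev , reads
    where
    open Antipodal antipodal

    a : Fin n → Fin (2 * n)
    a i = shift zero (toℕ i)

    π : Fin n → Fin n
    π i = lab B (a i)

    toℕ-a : ∀ i → toℕ (a i) ≡ toℕ i
    toℕ-a i = toℕ-shift-zero (<-≤-trans (toℕ<n i) (m≤m+n n _))

    partner-a : ∀ i → partner B (a i) ≡ shift zero (n + toℕ i)
    partner-a i = trans (partner≡shift (a i)) (trans (shift-+ zero (toℕ i) n) (cong (shift zero) (+-comm (toℕ i) n)))

    toℕ-partner-a : ∀ i → toℕ (partner B (a i)) ≡ n + toℕ i
    toℕ-partner-a i = trans (cong toℕ (partner-a i)) (toℕ-shift-zero (n+i<2n (toℕ<n i)))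

    first-end : Fin (2 * n) → Fin (2 * n)
    first-end p with toℕ p <? n
    ... | yes _ = p
    ... | no  _ = partner B p

    first-end-a : ∀ i {p} → lab B p ≡ lab B (a i) → first-end p ≡ a i
    first-end-a i same with two-ends B (a i) _ (sym same)
    ... | inj₁ refl with toℕ (a i) <? n
    ...   | yes _   = refl
    ...   | no  a≮n = contradiction (subst (_< n) (sym (toℕ-a i)) (toℕ<n i)) a≮n
    first-end-a i same | inj₂ refl with toℕ (partner B (a i)) <? n
    ...   | yes a′<n = contradiction (subst (_< n) (toℕ-partner-a i) a′<n) (m+n≮m n _)
    ...   | no  _    = partner-inv B (a i)

    rev : Fin n → Bool
    rev e = not (sgn B (first-end (proj₁ (every-loop B e))))

    rev-π : ∀ i → rev (π i) ≡ not (sgn B (a i))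
    rev-π i = cong (not ∘ sgn B) (first-end-a i (proj₂ (every-loop B (π i))))

    sgn-partner-a : ∀ i → sgn B (shift zero (n + toℕ i)) ≡ not (sgn B (a i))
    sgn-partner-a i = trans (cong (sgn B) (sym (partner-a i))) (xor≡true⇒≡not {sgn B (a i)} (all-twisted (a i)))

    reads : ∀ i → _
    reads i =
        refl
      , trans (cong (sgn B (a i) xor_) (rev-π i)) (xor-inverseʳ (sgn B (a i)))
      , trans (cong (lab B) (sym (partner-a i))) (partner-lab B (a i))
      , trans (cong₂ _xor_ (sgn-partner-a i) (rev-π i)) (xor-same (not (sgn B (a i))))

  step-involutive⇔standard : (∀ q → partner B q ≢ next q) → (∀ x → step B (step B x) ≡ x) ⇔ HasStandardRotation B
  step-involutive⇔standard no-adjacent-ends = mk⇔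
    (λ involutive → antipodal⇒standard (step-involutive⇒antipodal involutive no-adjacent-ends))
    (antipodal⇒step-involutive ∘ standard⇒antipodal)

lemma3p4 : (n : ℕ) → 2 ≤ n → (B : Bouquet n) → Prime B →
    f B ≤ n × (f B ≡ n ⇔ HasStandardRotation B)
lemma3p4 (suc (suc k)) (s≤s (s≤s z≤n)) B prime =
    faces≤edges B no-adjacent-ends
  , ⇔.trans (faces≡edges⇔step-involutive B no-adjacent-ends) (step-involutive⇔standard B no-adjacent-ends)
  where
  no-adjacent-ends : ∀ q → partner B q ≢ next q
  no-adjacent-ends = prime⇒no-adjacent-ends B prime
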